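{- Let $\mathcal{M}=\langle M,\in^{\mathcal{M}}\rangle$ be a model of $\mathrm{BAS}$. Then there exists a model $\mathcal{N}=\langle N,\mathcal{S}^{\mathcal{N}},\in^{\mathcal{N}}\rangle$ of $\mathrm{BAC}$ such that $\mathcal{M}\cong\langle\mathcal{S}^{\mathcal{N}},\in^{\mathcal{N}}\rangle$ (the restriction of $\in^{\mathcal{N}}$ to $\mathcal{S}^{\mathcal{N}}$).
   Context: $\mathrm{BAS}$ is the theory in the language $\{\in\}$ with axioms: (Emp) $\exists x\forall y(y\notin x)$; (Adj) $\forall x\forall y\exists z\forall u(u\in z\iff(u\in x\lor u=y))$; (Ext) extensionality; (Union) $\forall x\forall y\exists z\forall u(u\in z\iff u\in x\lor u\in y)$; (Intersection) $\forall x\forall y\exists z\forall u(u\in z\iff u\in x\land u\in y)$; (RelComp) $\forall x\forall y\exists z\forall u(u\in z\iff u\in x\land u\notin y)$; (UB) $\forall x\exists y(y\notin x)$. $\mathcal{L}_{cl}$ has binary $\in$ and unary $\mathcal{S}$; elements of $\mathcal{S}^{\mathcal{N}}$ are sets, all elements are classes (lowercase variables range over sets, uppercase over classes). $\mathrm{BAC}$ has axioms: (Mem) if $X\in Y$ then $X$ is a set; (Subset) if $x$ is a set and every set in $X$ is in $x$ then $X$ is a set; (Emp) there is a set with no set members; (Adj) for sets $x,y$ there is a set whose set members are exactly those of $x$ together with $y$; (CExt) classes with the same set members are equal; (Union) for sets $x,y$ there is a set whose set members are those in $x$ or $y$; (UB) for every set $x$ there is a set $y\notin x$; (CUnion),(CIntersection)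 for classes $X,Y$ there are classes whose set members are those in $X$ or $Y$, resp. in both; (CComp) every class $X$ has a class whose set members are exactly the sets not in $X$. -}

module Defs where

open import Data.Product using (Σ; ∃; ∃-syntax; _×_; _,_; proj₁; proj₂)
open import Data.Sum using (_⊎_)
open import Relation.Nullary using (¬_)
open import Relation.Binary.PropositionalEquality using (_≡_)
open import Function.Bundles using (_⇔_)

-- A structure for the language {∈}: a carrier with a binary relation.
-- Equality of the object language is interpreted as _≡_ on the carrier.
record ∈-Structure : Set₁ where
  field
    M   : Set
    _∈_ : M → M → Set

record IsBAS (𝓜 : ∈-Structure) : Set where
  open ∈-Structure 𝓜
  field
    emp   : ∃[ x ] (∀ y → ¬ (y ∈ x))
    adj   : ∀ x y → ∃[ z ] (∀ u → (u ∈ z) ⇔ (u ∈ x ⊎ u ≡ y))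
    ext   : ∀ x y → (∀ u → (u ∈ x) ⇔ (u ∈ y)) → x ≡ y
    union : ∀ x y → ∃[ z ] (∀ u → (u ∈ z) ⇔ (u ∈ x ⊎ u ∈ y))
    inter : ∀ x y → ∃[ z ] (∀ u → (u ∈ z) ⇔ (u ∈ x × u ∈ y))
    relComp : ∀ x y → ∃[ z ] (∀ u → (u ∈ z) ⇔ (u ∈ x × ¬ (u ∈ y)))
    ub    : ∀ x → ∃[ y ] (¬ (y ∈ x))

record cl-Structure : Set₁ where
  field
    N   : Set
    𝒮   : N → Set
    _∈_ : N → N → Set

-- Axioms of BAC (lowercase variables range over sets, i.e. elements satisfying 𝒮)
record IsBAC (𝓝 : cl-Structure) : Set where
  open cl-Structure 𝓝
  field
    mem    : ∀ X Y → X ∈ Y → 𝒮 X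
    subset : ∀ x X → 𝒮 x → (∀ u → 𝒮 u → u ∈ X → u ∈ x) → 𝒮 X
    emp    : ∃[ x ] (𝒮 x × (∀ u → 𝒮 u → ¬ (u ∈ x)))
    adj    : ∀ x y → 𝒮 x → 𝒮 y →
             ∃[ z ] (𝒮 z × (∀ u → 𝒮 u → (u ∈ z) ⇔ (u ∈ x ⊎ u ≡ y)))
    cext   : ∀ X Y → (∀ u → 𝒮 u → (u ∈ X) ⇔ (u ∈ Y)) → X ≡ Y
    union  : ∀ x y → 𝒮 x → 𝒮 y →
             ∃[ z ] (𝒮 z × (∀ u → 𝒮 u → (u ∈ z) ⇔ (u ∈ x ⊎ u ∈ y)))
    ub     : ∀ x → 𝒮 x → ∃[ y ] (𝒮 y × ¬ (y ∈ x))
    cunion : ∀ X Y → ∃[ Z ] (∀ u → 𝒮 u → (u ∈ Z) ⇔ (u ∈ X ⊎ u ∈ Y))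
    cinter : ∀ X Y → ∃[ Z ] (∀ u → 𝒮 u → (u ∈ Z) ⇔ (u ∈ X × u ∈ Y))
    ccomp  : ∀ X → ∃[ Z ] (∀ u → 𝒮 u → (u ∈ Z) ⇔ (¬ (u ∈ X)))

setPart : cl-Structure → ∈-Structure
setPart 𝓝 = record
  { M   = Σ N 𝒮
  ; _∈_ = λ x y → proj₁ x ∈ proj₁ y
  }
  where open cl-Structure 𝓝

record _≅_ (𝓐 𝓑 : ∈-Structure) : Set where
  module A = ∈-Structure 𝓐
  module B = ∈-Structure 𝓑
  field
    to       : A.M → B.M
    from     : B.M → A.M
    from∘to  : ∀ x → from (to x) ≡ x
    to∘from  : ∀ y → to (from y) ≡ y
    preserve : ∀ x y → (x A.∈ y) ⇔ (to x B.∈ to y)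

-- Take as classes the sets of 𝓜 together with formal complements of sets, and
-- let only the former be sets.  Complementation swaps the two kinds,
-- intersections of classes are computed by intersection, relative complement
-- and union in 𝓜, and unions follow by De Morgan; excluded middle is needed
-- because a set has to be recovered from its double complement.  UB makes the
-- representation faithful: no complement of a set is contained in a set, which
-- gives both class extensionality and the Subset axiom.

module Submission where

open import Defs
open import Data.Product using (∃-syntax; _×_; _,_; proj₁; proj₂; swap)
open import Data.Sum using (_⊎_; inj₁; inj₂; [_,_])
open import Data.Product.Function.NonDependent.Propositional using (_×-⇔_)
open import Data.Sum.Function.Propositional using (_⊎-⇔_)
open import Data.Unit using (⊤; tt)
open import Data.Empty using (⊥; ⊥-elim)
open import Axiom.ExcludedMiddle using (ExcludedMiddle)
open import Axiom.DoubleNegationElimination using (em⇒dne)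
open import Level using (0ℓ)
open import Function.Base using (_∘_)
open import Function.Bundles using (_⇔_; mk⇔; Equivalence)
open import Function.Properties.Equivalence using ()
  renaming (refl to ⇔-refl; sym to ⇔-sym; trans to ⇔-trans)
open import Function.Related.TypeIsomorphisms using (¬-cong-⇔)
open import Function.Related.Propositional using (module EquationalReasoning; equivalence)
open import Relation.Nullary using (¬_)
open import Relation.Binary.PropositionalEquality using (_≡_; refl; cong)

open Equivalence using (to; from)

module Classical (em : ExcludedMiddle 0ℓ) where

  ¬¬-elim : {P : Set} → ¬ ¬ P → P
  ¬¬-elim = em⇒dne em

  ⇔¬¬ : {P : Set} → P ⇔ (¬ ¬ P)
  ⇔¬¬ = mk⇔ (λ p ¬p → ¬p p) ¬¬-elim

  ¬-cong-⇔⁻¹ : {P Q : Set} → (¬ P) ⇔ (¬ Q) → P ⇔ Q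
  ¬-cong-⇔⁻¹ ¬P⇔¬Q = ⇔-trans ⇔¬¬ (⇔-trans (¬-cong-⇔ ¬P⇔¬Q) (⇔-sym ⇔¬¬))

  ¬⊎⇔¬×¬ : {P Q : Set} → (¬ (P ⊎ Q)) ⇔ (¬ P × ¬ Q)
  ¬⊎⇔¬×¬ = mk⇔ (λ ¬p⊎q → ¬p⊎q ∘ inj₁ , ¬p⊎q ∘ inj₂) (λ (¬p , ¬q) → [ ¬p , ¬q ])

  ¬[¬×¬]⇔⊎ : {P Q : Set} → (¬ (¬ P × ¬ Q)) ⇔ (P ⊎ Q)
  ¬[¬×¬]⇔⊎ = ⇔-trans (¬-cong-⇔ (⇔-sym ¬⊎⇔¬×¬)) (⇔-sym ⇔¬¬)

module BASOperations (𝓜 : ∈-Structure) (bas : IsBAS 𝓜) where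
  open ∈-Structure 𝓜
  open IsBAS bas

  infixl 30 _∪_ _∩_ _∖_

  _∪_ _∩_ _∖_ adjoin : M → M → M
  a ∪ b = proj₁ (union a b)
  a ∩ b = proj₁ (inter a b)
  a ∖ b = proj₁ (relComp a b)
  adjoin a b = proj₁ (adj a b)

  module _ {u : M} (a b : M) where
    ∈-∪ : (u ∈ a ∪ b) ⇔ (u ∈ a ⊎ u ∈ b)
    ∈-∪ = proj₂ (union a b) u

    ∈-∩ : (u ∈ a ∩ b) ⇔ (u ∈ a × u ∈ b)
    ∈-∩ = proj₂ (inter a b) u

    ∈-∖ : (u ∈ a ∖ b) ⇔ (u ∈ a × ¬ u ∈ b)
    ∈-∖ = proj₂ (relComp a b) u

    ∈-adjoin : (u ∈ adjoin a b) ⇔ (u ∈ a ⊎ u ≡ b)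
    ∈-adjoin = proj₂ (adj a b) u

  -- Otherwise the set a ∪ b would contain everything, against UB.
  complement⊈set : ∀ a b → ¬ (∀ u → ¬ u ∈ b → u ∈ a)
  complement⊈set a b ∁b⊆a with ub (a ∪ b)
  ... | w , w∉a∪b = w∉a∪b (from (∈-∪ a b) (inj₁ (∁b⊆a w (w∉a∪b ∘ from (∈-∪ a b) ∘ inj₂))))

module ClassesOfComplements (em : ExcludedMiddle 0ℓ) (𝓜 : ∈-Structure) (bas : IsBAS 𝓜) where
  open ∈-Structure 𝓜
  open IsBAS bas using (emp; ext; ub)
  open BASOperations 𝓜 bas
  open Classical em

  data Class : Set where
    set   : M → Class
    compl : M → Class

  _∈ᶜ_ : M → Class → Set
  u ∈ᶜ set a   = u ∈ a
  u ∈ᶜ compl a = ¬ u ∈ a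

  ∁ : Class → Class
  ∁ (set a)   = compl a
  ∁ (compl a) = set a

  ∈-∁ : ∀ {u} X → (u ∈ᶜ ∁ X) ⇔ (¬ u ∈ᶜ X)
  ∈-∁ (set a)   = ⇔-refl
  ∈-∁ (compl a) = ⇔¬¬

  infixl 30 _⊓_ _⊔_

  _⊓_ : Class → Class → Class
  set a   ⊓ set b   = set (a ∩ b)
  set a   ⊓ compl b = set (a ∖ b)
  compl a ⊓ set b   = set (b ∖ a)
  compl a ⊓ compl b = compl (a ∪ b)

  ∈-⊓ : ∀ {u} X Y → (u ∈ᶜ X ⊓ Y) ⇔ (u ∈ᶜ X × u ∈ᶜ Y)
  ∈-⊓ (set a)   (set b)   = ∈-∩ a b
  ∈-⊓ (set a)   (compl b) = ∈-∖ a b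
  ∈-⊓ (compl a) (set b)   = ⇔-trans (∈-∖ b a) (mk⇔ swap swap)
  ∈-⊓ (compl a) (compl b) = ⇔-trans (¬-cong-⇔ (∈-∪ a b)) ¬⊎⇔¬×¬

  _⊔_ : Class → Class → Class
  X ⊔ Y = ∁ (∁ X ⊓ ∁ Y)

  ∈-⊔ : ∀ {u} X Y → (u ∈ᶜ X ⊔ Y) ⇔ (u ∈ᶜ X ⊎ u ∈ᶜ Y)
  ∈-⊔ {u} X Y = begin
    u ∈ᶜ ∁ (∁ X ⊓ ∁ Y)         ∼⟨ ∈-∁ (∁ X ⊓ ∁ Y) ⟩
    ¬ u ∈ᶜ ∁ X ⊓ ∁ Y           ∼⟨ ¬-cong-⇔ (∈-⊓ (∁ X) (∁ Y)) ⟩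
    ¬ (u ∈ᶜ ∁ X × u ∈ᶜ ∁ Y)    ∼⟨ ¬-cong-⇔ (∈-∁ X ×-⇔ ∈-∁ Y) ⟩
    ¬ (¬ u ∈ᶜ X × ¬ u ∈ᶜ Y)    ∼⟨ ¬[¬×¬]⇔⊎ ⟩
    (u ∈ᶜ X ⊎ u ∈ᶜ Y)          ∎
    where open EquationalReasoning {k = equivalence}

  -- A class is determined by its members because no complement equals a set.
  class-ext : ∀ X Y → (∀ u → (u ∈ᶜ X) ⇔ (u ∈ᶜ Y)) → X ≡ Y
  class-ext (set a)   (set b)   X≈Y = cong set (ext a b X≈Y)
  class-ext (set a)   (compl b) X≈Y = ⊥-elim (complement⊈set a b (from ∘ X≈Y))
  class-ext (compl a) (set b)   X≈Y = ⊥-elim (complement⊈set b a (to ∘ X≈Y))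
  class-ext (compl a) (compl b) X≈Y = cong compl (ext a b (¬-cong-⇔⁻¹ ∘ X≈Y))

  IsSet : Class → Set
  IsSet (set _)   = ⊤
  IsSet (compl _) = ⊥

  _∈ₙ_ : Class → Class → Set
  set u   ∈ₙ Y = u ∈ᶜ Y
  compl _ ∈ₙ _ = ⊥

  classes : cl-Structure
  classes = record { N = Class ; 𝒮 = IsSet ; _∈_ = _∈ₙ_ }

  onSets : {P : Class → Set} → (∀ u → P (set u)) → ∀ U → IsSet U → P U
  onSets P-set (set u) _ = P-set u

  set-injective : ∀ {a b} → set a ≡ set b → a ≡ b
  set-injective refl = refl

  classes-isBAC : IsBAC classes
  classes-isBAC = record
    { mem    = λ { (set _) _ _ → tt }
    ; subset = subset
    ; emp    = set (proj₁ emp) , tt , onSets (proj₂ emp)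
    ; adj    = λ { (set a) (set b) _ _ →
                 set (adjoin a b) , tt ,
                 onSets (λ u → ⇔-trans (∈-adjoin a b) (⇔-refl ⊎-⇔ mk⇔ (cong set) set-injective)) }
    ; cext   = λ X Y X≈Y → class-ext X Y (λ u → X≈Y (set u) tt)
    ; union  = λ { (set a) (set b) _ _ → set (a ∪ b) , tt , onSets (λ _ → ∈-∪ a b) }
    ; ub     = λ { (set a) _ → set (proj₁ (ub a)) , tt , proj₂ (ub a) }
    ; cunion = λ X Y → X ⊔ Y , onSets (λ _ → ∈-⊔ X Y)
    ; cinter = λ X Y → X ⊓ Y , onSets (λ _ → ∈-⊓ X Y)
    ; ccomp  = λ X → ∁ X , onSets (λ _ → ∈-∁ X)
    }
    where
    subset : ∀ x X → IsSet x → (∀ u → IsSet u → u ∈ₙ X → u ∈ₙ x) → IsSet X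
    subset (set a) (set b)   _ _    = tt
    subset (set a) (compl b) _ X⊆x = complement⊈set a b (λ u → X⊆x (set u) tt)

  sets≅ : 𝓜 ≅ setPart classes
  sets≅ = record
    { to       = λ a → set a , tt
    ; from     = λ { (set a , _) → a }
    ; from∘to  = λ _ → refl
    ; to∘from  = λ { (set _ , _) → refl }
    ; preserve = λ _ _ → ⇔-refl
    }

mainTheorem13 : ExcludedMiddle 0ℓ → (𝓜 : ∈-Structure) → IsBAS 𝓜 →
    ∃[ 𝓝 ] (IsBAC 𝓝 × (𝓜 ≅ setPart 𝓝))
mainTheorem13 em 𝓜 bas = classes , classes-isBAC , sets≅
  where open ClassesOfComplements em 𝓜 bas
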